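{- Let $D=\begin{pmatrix} I_r & M\end{pmatrix}$ be an $r\times n$ standard representative matrix with $\widehat D=\begin{pmatrix} -M^T & I_{n-r}\end{pmatrix}$. Then the rows of each of the matrices $\mathbf D'=\begin{pmatrix} I_r & M\\ 0 & \widehat D\widehat D^T\end{pmatrix}$ and $\mathbf D''=\begin{pmatrix} DD^T & 0\\ -M^T & I_{n-r}\end{pmatrix}$ form an integral basis for the lattice $\operatorname{im}_{\mathbb Z}(D^T)\oplus\ker_{\mathbb Z}(D)$.
   Context: $M$ is an $r\times(n-r)$ integer matrix. $\operatorname{im}_{\mathbb Z}(D^T)\subseteq\mathbb Z^n$ is the lattice of integer linear combinations of the rows of $D$, and $\ker_{\mathbb Z}(D)=\{z\in\mathbb Z^n: Dz=0\}$. An integral basis of a lattice is a linearly independent set of vectors generating it over $\mathbb Z$. -}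

module Defs where

open import Data.Nat using (ℕ; zero; suc; _+_)
open import Data.Integer as ℤ using (ℤ; 0ℤ; 1ℤ) renaming (_+_ to _+ℤ_; _*_ to _*ℤ_; -_ to -ℤ_)
open import Data.Fin using (Fin; splitAt) renaming (zero to fzero; suc to fsuc)
open import Data.Fin.Properties using () renaming (_≟_ to _≟ᶠ_)
open import Data.Sum using (_⊎_; inj₁; inj₂; [_,_])
open import Data.Product using (Σ; ∃; _×_; _,_)
open import Relation.Binary.PropositionalEquality using (_≡_)
open import Relation.Nullary using (yes; no)

Vec : ℕ → Set
Vec n = Fin n → ℤ

Mat : ℕ → ℕ → Set
Mat m n = Fin m → Fin n → ℤ

Σᶠ : ∀ {n} → (Fin n → ℤ) → ℤ
Σᶠ {zero}  f = 0ℤ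
Σᶠ {suc n} f = f fzero +ℤ Σᶠ (λ i → f (fsuc i))

_≈ᵥ_ : ∀ {n} → Vec n → Vec n → Set
u ≈ᵥ v = ∀ j → u j ≡ v j

zeroV : ∀ {n} → Vec n
zeroV _ = 0ℤ

I : ∀ m → Mat m m
I m i j with i ≟ᶠ j
... | yes _ = 1ℤ
... | no  _ = 0ℤ

transpose : ∀ {m n} → Mat m n → Mat n m
transpose A i j = A j i

_·_ : ∀ {m l n} → Mat m l → Mat l n → Mat m n
(A · B) i j = Σᶠ (λ t → A i t *ℤ B t j)

negM : ∀ {m n} → Mat m n → Mat m n
negM A i j = -ℤ A i j

zeroM : ∀ {m n} → Mat m n
zeroM _ _ = 0ℤ

hcat : ∀ {m a b} → Mat m a → Mat m b → Mat m (a + b)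
hcat {a = a} A B i j = [ (λ c → A i c) , (λ c → B i c) ] (splitAt a j)

vcat : ∀ {a b n} → Mat a n → Mat b n → Mat (a + b) n
vcat {a = a} A B i = [ A , B ] (splitAt a i)

-- D = ( I_r  M ),  D̂ = ( -Mᵀ  I_{n-r} ),  with n = r + k
Dmat : ∀ {r k} → Mat r k → Mat r (r + k)
Dmat {r} M = hcat (I r) M

Dhat : ∀ {r k} → Mat r k → Mat k (r + k)
Dhat {k = k} M = hcat (negM (transpose M)) (I k)

D′ : ∀ {r k} → Mat r k → Mat (r + k) (r + k)
D′ M = vcat (Dmat M) (hcat zeroM (Dhat M · transpose (Dhat M)))

D″ : ∀ {r k} → Mat r k → Mat (r + k) (r + k)
D″ {k = k} M = vcat (hcat (Dmat M · transpose (Dmat M)) zeroM) (hcat (negM (transpose M)) (I k))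

comb : ∀ {m n} → Vec m → Mat m n → Vec n
comb c A j = Σᶠ (λ i → c i *ℤ A i j)

InImT : ∀ {m n} → Mat m n → Vec n → Set
InImT A v = ∃ λ c → comb c A ≈ᵥ v

InKer : ∀ {m n} → Mat m n → Vec n → Set
InKer A v = ∀ i → Σᶠ (λ j → A i j *ℤ v j) ≡ 0ℤ

InImKer : ∀ {m n} → Mat m n → Vec n → Set
InImKer A v = ∃ λ x → ∃ λ y → InImT A x × InKer A y × (∀ j → v j ≡ x j +ℤ y j)

IntegralBasis : ∀ {m n} → Mat m n → (Vec n → Set) → Set
IntegralBasis B L =
  (∀ i → L (B i)) ×
  (∀ v → L v → ∃ λ c → comb c B ≈ᵥ v) ×
  (∀ c → comb c B ≈ᵥ zeroV → ∀ i → c i ≡ 0ℤ)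

module Submission where

-- Write n = r + k, D = ( I_r  M ) and D̂ = ( -Mᵀ  I_k ), and let
-- L = im_ℤ(Dᵀ) ⊕ ker_ℤ(D).  The proof has two halves.
--
-- 1. The stacked matrix E = ( D ; D̂ ) parametrises L: every integer
--    combination of its rows lies in L (D D̂ᵀ = 0), every element of L is
--    one (a kernel vector y satisfies y₁ = -M y₂, so y = y₂ D̂), and the
--    combination is unique.  Uniqueness is a sum-of-squares argument:
--    aD + bD̂ = 0 means a = M b and aM = -b, hence |a|² = ⟨a , M b⟩ =
--    ⟨aM , b⟩ = -|b|², forcing a = b = 0.
-- 2. D′ and D″ arise from E by block-unitriangular row operations:
--    cD′ = (c₁ + M c₂ , c₂) E and cD″ = (c₁ , c₂ - c₁ M) E, computed from
--    D̂ D̂ᵀ = I + MᵀM and D Dᵀ = I + M Mᵀ.  Such coordinate changes are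
--    invertible, and an invertible change of coordinates turns a
--    parametrisation of L into an integral basis of L.

open import Defs
open import Data.Nat as ℕ using (ℕ; zero; suc)
import Data.Nat.Properties as ℕ
open import Data.Integer using (ℤ; 0ℤ; 1ℤ; -[1+_]; ∣_∣; _+_; _*_; -_) renaming (+_ to pos)
import Data.Integer.Properties as ℤ
open import Data.Integer.Tactic.RingSolver using (solve-∀)
open import Algebra.Bundles using (AbelianGroup)
open import Algebra.Properties.Ring ℤ.+-*-ring using (-1*x≈-x)
open import Algebra.Properties.Group (AbelianGroup.group ℤ.+-0-abelianGroup)
  using (x∙y⁻¹≈ε⇒x≈y; inverseˡ-unique)
open import Algebra.Properties.Semiring.Sum ℤ.+-*-semiring
  using (sum; sum-cong-≗; sum-replicate-zero; sum-remove; ∑-distrib-+; ∑-comm;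
         *-distribˡ-sum; *-distribʳ-sum)
open import Data.Fin using (Fin; splitAt; punchIn; _↑ˡ_; _↑ʳ_) renaming (zero to fzero; suc to fsuc)
open import Data.Fin.Properties using (join-splitAt; punchInᵢ≢i) renaming (_≟_ to _≟ᶠ_)
open import Data.Vec.Functional using (_++_)
open import Data.Vec.Functional.Properties using (lookup-++ˡ; lookup-++ʳ; ++-cong)
open import Data.Sum using (inj₁; inj₂)
open import Data.Sum.Properties using ([,]-∘)
open import Data.Product using (_×_; _,_; ∃; proj₁; proj₂)
open import Data.Empty using (⊥-elim)
open import Function using (_∘_)
open import Relation.Nullary using (yes; no)
open import Relation.Binary.PropositionalEquality

Σᶠ≡sum : ∀ {n} (f : Vec n) → Σᶠ f ≡ sum f
Σᶠ≡sum {zero}  f = refl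
Σᶠ≡sum {suc n} f = cong (f fzero +_) (Σᶠ≡sum (f ∘ fsuc))

Σ-cong : ∀ {n} {f g : Vec n} → f ≈ᵥ g → Σᶠ f ≡ Σᶠ g
Σ-cong {f = f} {g} e = trans (Σᶠ≡sum f) (trans (sum-cong-≗ e) (sym (Σᶠ≡sum g)))

Σ-zero : ∀ {n} (f : Vec n) → f ≈ᵥ zeroV → Σᶠ f ≡ 0ℤ
Σ-zero {n} f e = trans (Σ-cong {g = zeroV} e) (trans (Σᶠ≡sum {n} zeroV) (sum-replicate-zero n))

Σ-+ : ∀ {n} (f g : Vec n) → Σᶠ (λ i → f i + g i) ≡ Σᶠ f + Σᶠ g
Σ-+ f g = trans (Σᶠ≡sum (λ i → f i + g i))
  (trans (∑-distrib-+ f g) (sym (cong₂ _+_ (Σᶠ≡sum f) (Σᶠ≡sum g))))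

Σ-*ˡ : ∀ {n} a (f : Vec n) → Σᶠ (λ i → a * f i) ≡ a * Σᶠ f
Σ-*ˡ a f = trans (Σᶠ≡sum (λ i → a * f i))
  (trans (sym (*-distribˡ-sum a f)) (cong (a *_) (sym (Σᶠ≡sum f))))

Σ-*ʳ : ∀ {n} a (f : Vec n) → Σᶠ (λ i → f i * a) ≡ Σᶠ f * a
Σ-*ʳ a f = trans (Σᶠ≡sum (λ i → f i * a))
  (trans (sym (*-distribʳ-sum a f)) (cong (_* a) (sym (Σᶠ≡sum f))))

Σ-neg : ∀ {n} (f : Vec n) → Σᶠ (λ i → - f i) ≡ - Σᶠ f
Σ-neg f = trans (Σ-cong (λ i → sym (-1*x≈-x (f i))))
  (trans (Σ-*ˡ (- 1ℤ) f) (-1*x≈-x (Σᶠ f)))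

Σ-swap : ∀ {m n} (f : Fin m → Fin n → ℤ) →
  Σᶠ (λ i → Σᶠ (f i)) ≡ Σᶠ (λ j → Σᶠ (λ i → f i j))
Σ-swap f = trans (double f) (trans (∑-comm f) (sym (double (λ j i → f i j))))
  where
  double : ∀ {m n} (g : Fin m → Fin n → ℤ) → Σᶠ (λ i → Σᶠ (g i)) ≡ sum (λ i → sum (g i))
  double g = trans (Σᶠ≡sum (λ i → Σᶠ (g i))) (sum-cong-≗ (λ i → Σᶠ≡sum (g i)))

Σ-split : ∀ {r k} (f : Vec (r ℕ.+ k)) → Σᶠ f ≡ Σᶠ (f ∘ (_↑ˡ k)) + Σᶠ (f ∘ (r ↑ʳ_))
Σ-split {zero}  f = sym (ℤ.+-identityˡ _)
Σ-split {suc r} f = trans (cong (f fzero +_) (Σ-split {r} (f ∘ fsuc))) (sym (ℤ.+-assoc (f fzero) _ _))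

Σ-single : ∀ {n} (h : Vec n) i → (∀ j → j ≢ i → h j ≡ 0ℤ) → Σᶠ h ≡ h i
Σ-single {suc n} h i off = begin
  Σᶠ h                       ≡⟨ Σᶠ≡sum h ⟩
  sum h                      ≡⟨ sum-remove {i = i} h ⟩
  h i + sum (h ∘ punchIn i)  ≡⟨ cong (h i +_) rest ⟩
  h i + 0ℤ                   ≡⟨ ℤ.+-identityʳ (h i) ⟩
  h i                        ∎
  where
  open ≡-Reasoning
  rest : sum (h ∘ punchIn i) ≡ 0ℤ
  rest = trans (sum-cong-≗ (λ j → off (punchIn i j) (punchInᵢ≢i i j))) (sum-replicate-zero n)

I-diag : ∀ {n} (i : Fin n) → I n i i ≡ 1ℤ
I-diag i with i ≟ᶠ i
... | yes _  = refl
... | no i≢i = ⊥-elim (i≢i refl)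

I-off : ∀ {n} (i j : Fin n) → i ≢ j → I n i j ≡ 0ℤ
I-off i j i≢j with i ≟ᶠ j
... | yes i≡j = ⊥-elim (i≢j i≡j)
... | no _    = refl

infixl 22 _+ᵥ_
_+ᵥ_ : ∀ {n} → Vec n → Vec n → Vec n
(u +ᵥ v) i = u i + v i

infix 23 -ᵥ_
-ᵥ_ : ∀ {n} → Vec n → Vec n
(-ᵥ u) i = - u i

dot : ∀ {n} → Vec n → Vec n → ℤ
dot u v = Σᶠ (λ i → u i * v i)

module Blocks (r k : ℕ) where

  top : Vec (r ℕ.+ k) → Vec r
  top x s = x (s ↑ˡ k)

  bot : Vec (r ℕ.+ k) → Vec k
  bot x t = x (r ↑ʳ t)

  split-++ : ∀ u → u ≈ᵥ (top u ++ bot u)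
  split-++ u i = trans (cong u (sym (join-splitAt r k i))) ([,]-∘ u (splitAt r i))

  blocks-ext : ∀ u v → top u ≈ᵥ top v → bot u ≈ᵥ bot v → u ≈ᵥ v
  blocks-ext u v top≈ bot≈ i =
    trans (split-++ u i) (trans (++-cong (top u) (top v) top≈ bot≈ i) (sym (split-++ v i)))

+ᵥ-++ : ∀ {r k} (u u′ : Vec r) (v v′ : Vec k) → (u ++ v) +ᵥ (u′ ++ v′) ≈ᵥ ((u +ᵥ u′) ++ (v +ᵥ v′))
+ᵥ-++ {r} u u′ v v′ i with splitAt r i
... | inj₁ s = refl
... | inj₂ t = refl

-- Row and column calculus.  'comb c A' is the row vector c A, and
-- 'A ·ᵥ y' the column vector A y.

infixr 24 _·ᵥ_
_·ᵥ_ : ∀ {m n} → Mat m n → Vec n → Vec m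
(A ·ᵥ y) i = dot (A i) y

comb-cong : ∀ {m n} {c c′ : Vec m} (A : Mat m n) → c ≈ᵥ c′ → comb c A ≈ᵥ comb c′ A
comb-cong A e j = Σ-cong (λ i → cong (_* A i j) (e i))

·ᵥ-cong : ∀ {m n} (A : Mat m n) {y y′ : Vec n} → y ≈ᵥ y′ → A ·ᵥ y ≈ᵥ A ·ᵥ y′
·ᵥ-cong A e i = Σ-cong (λ j → cong (A i j *_) (e j))

comb-+ : ∀ {m n} (c c′ : Vec m) (A : Mat m n) → comb (c +ᵥ c′) A ≈ᵥ comb c A +ᵥ comb c′ A
comb-+ c c′ A j = trans (Σ-cong (λ i → ℤ.*-distribʳ-+ (A i j) (c i) (c′ i)))
  (Σ-+ (λ i → c i * A i j) (λ i → c′ i * A i j))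

·ᵥ-+ : ∀ {m n} (A : Mat m n) (u v : Vec n) → A ·ᵥ (u +ᵥ v) ≈ᵥ A ·ᵥ u +ᵥ A ·ᵥ v
·ᵥ-+ A u v i = trans (Σ-cong (λ j → ℤ.*-distribˡ-+ (A i j) (u j) (v j)))
  (Σ-+ (λ j → A i j * u j) (λ j → A i j * v j))

·ᵥ-neg : ∀ {m n} (A : Mat m n) (y : Vec n) → A ·ᵥ (-ᵥ y) ≈ᵥ -ᵥ (A ·ᵥ y)
·ᵥ-neg A y i = trans (Σ-cong (λ j → sym (ℤ.neg-distribʳ-* (A i j) (y j)))) (Σ-neg (λ j → A i j * y j))

·ᵥ-zero : ∀ {m n} (A : Mat m n) → A ·ᵥ zeroV ≈ᵥ zeroV
·ᵥ-zero A i = Σ-zero _ (λ j → ℤ.*-zeroʳ (A i j))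

negM-·ᵥ : ∀ {m n} (A : Mat m n) (y : Vec n) → negM A ·ᵥ y ≈ᵥ -ᵥ (A ·ᵥ y)
negM-·ᵥ A y i = trans (Σ-cong (λ j → sym (ℤ.neg-distribˡ-* (A i j) (y j)))) (Σ-neg (λ j → A i j * y j))

comb-negM : ∀ {m n} (c : Vec m) (A : Mat m n) → comb c (negM A) ≈ᵥ -ᵥ comb c A
comb-negM c A j = trans (Σ-cong (λ i → sym (ℤ.neg-distribʳ-* (c i) (A i j)))) (Σ-neg (λ i → c i * A i j))

comb-zeroM : ∀ {m n} (c : Vec m) → comb c (zeroM {m} {n}) ≈ᵥ zeroV
comb-zeroM c j = Σ-zero _ (λ i → ℤ.*-zeroʳ (c i))

comb-I : ∀ {n} (c : Vec n) → comb c (I n) ≈ᵥ c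
comb-I c j = trans (Σ-single _ j (λ i i≢j → trans (cong (c i *_) (I-off i j i≢j)) (ℤ.*-zeroʳ (c i))))
  (trans (cong (c j *_) (I-diag j)) (ℤ.*-identityʳ (c j)))

I-·ᵥ : ∀ {n} (y : Vec n) → I n ·ᵥ y ≈ᵥ y
I-·ᵥ y i = trans (Σ-single _ i (λ j j≢i → cong (_* y j) (I-off i j (j≢i ∘ sym))))
  (trans (cong (_* y i) (I-diag i)) (ℤ.*-identityˡ (y i)))

comb-transpose : ∀ {m n} (y : Vec n) (A : Mat m n) → comb y (transpose A) ≈ᵥ A ·ᵥ y
comb-transpose y A i = Σ-cong (λ j → ℤ.*-comm (y j) (A i j))

dot-adjoint : ∀ {m n} (a : Vec m) (A : Mat m n) (b : Vec n) → dot a (A ·ᵥ b) ≡ dot (comb a A) b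
dot-adjoint a A b = begin
  Σᶠ (λ i → a i * Σᶠ (λ t → A i t * b t))    ≡⟨ Σ-cong (λ i → sym (Σ-*ˡ (a i) (λ t → A i t * b t))) ⟩
  Σᶠ (λ i → Σᶠ (λ t → a i * (A i t * b t)))  ≡⟨ Σ-swap (λ i t → a i * (A i t * b t)) ⟩
  Σᶠ (λ t → Σᶠ (λ i → a i * (A i t * b t)))  ≡⟨ Σ-cong (λ t → Σ-cong (λ i → sym (ℤ.*-assoc (a i) (A i t) (b t)))) ⟩
  Σᶠ (λ t → Σᶠ (λ i → a i * A i t * b t))    ≡⟨ Σ-cong (λ t → Σ-*ʳ (b t) (λ i → a i * A i t)) ⟩
  Σᶠ (λ t → comb a A t * b t)                ∎
  where open ≡-Reasoning

-- Associativity c (A B) = (c A) B is the adjunction applied to columns of B.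
comb-· : ∀ {m l n} (c : Vec m) (A : Mat m l) (B : Mat l n) → comb c (A · B) ≈ᵥ comb (comb c A) B
comb-· c A B j = dot-adjoint c A (λ t → B t j)

comb-hcat : ∀ {m a b} (c : Vec m) (A : Mat m a) (B : Mat m b) → comb c (hcat A B) ≈ᵥ (comb c A ++ comb c B)
comb-hcat {a = a} c A B j with splitAt a j
... | inj₁ s = refl
... | inj₂ t = refl

comb-vcat : ∀ {a b n} (c : Vec (a ℕ.+ b)) (A : Mat a n) (B : Mat b n) →
  comb c (vcat A B) ≈ᵥ comb (c ∘ (_↑ˡ b)) A +ᵥ comb (c ∘ (a ↑ʳ_)) B
comb-vcat {a} {b} c A B j = trans (Σ-split {a} {b} (λ i → c i * vcat A B i j))
  (cong₂ _+_ (Σ-cong (λ s → cong (λ row → c (s ↑ˡ b) * row j) (lookup-++ˡ A B s)))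
             (Σ-cong (λ t → cong (λ row → c (a ↑ʳ t) * row j) (lookup-++ʳ A B t))))

·ᵥ-hcat : ∀ {m a b} (A : Mat m a) (B : Mat m b) (u : Vec a) (v : Vec b) →
  hcat A B ·ᵥ (u ++ v) ≈ᵥ A ·ᵥ u +ᵥ B ·ᵥ v
·ᵥ-hcat {a = a} {b} A B u v i = trans (Σ-split {a} {b} (λ j → hcat A B i j * (u ++ v) j))
  (cong₂ _+_ (Σ-cong (λ s → cong₂ _*_ (lookup-++ˡ (A i) (B i) s) (lookup-++ˡ u v s)))
             (Σ-cong (λ t → cong₂ _*_ (lookup-++ʳ (A i) (B i) t) (lookup-++ʳ u v t))))

normSq : ∀ {n} → Vec n → ℕ
normSq {zero}  u = 0
normSq {suc n} u = ∣ u fzero ∣ ℕ.* ∣ u fzero ∣ ℕ.+ normSq (u ∘ fsuc)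

square≡ : ∀ x → x * x ≡ pos (∣ x ∣ ℕ.* ∣ x ∣)
square≡ (pos n)      = ℤ.+◃n≡+n (n ℕ.* n)
square≡ -[1+ n ]     = ℤ.+◃n≡+n (suc n ℕ.* suc n)

dot-self : ∀ {n} (u : Vec n) → dot u u ≡ pos (normSq u)
dot-self {zero}  u = refl
dot-self {suc n} u = cong₂ _+_ (square≡ (u fzero)) (dot-self (u ∘ fsuc))

normSq-zero : ∀ {n} (u : Vec n) → normSq u ≡ 0 → u ≈ᵥ zeroV
normSq-zero {suc n} u e fzero    = square-zero (u fzero) (ℕ.m+n≡0⇒m≡0 _ e)
  where
  square-zero : ∀ x → ∣ x ∣ ℕ.* ∣ x ∣ ≡ 0 → x ≡ 0ℤ
  square-zero x e′ with ℕ.m*n≡0⇒m≡0∨n≡0 ∣ x ∣ e′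
  ... | inj₁ ∣x∣≡0 = ℤ.∣i∣≡0⇒i≡0 ∣x∣≡0
  ... | inj₂ ∣x∣≡0 = ℤ.∣i∣≡0⇒i≡0 ∣x∣≡0
normSq-zero {suc n} u e (fsuc i) = normSq-zero (u ∘ fsuc) (ℕ.m+n≡0⇒n≡0 _ e) i

squares-vanish : ∀ {m n} (u : Vec m) (v : Vec n) → dot u u + dot v v ≡ 0ℤ → u ≈ᵥ zeroV × v ≈ᵥ zeroV
squares-vanish u v e =
  normSq-zero u (ℕ.m+n≡0⇒m≡0 _ sum≡0) , normSq-zero v (ℕ.m+n≡0⇒n≡0 (normSq u) sum≡0)
  where
  sum≡0 : normSq u ℕ.+ normSq v ≡ 0
  sum≡0 = ℤ.+-injective (trans (sym (cong₂ _+_ (dot-self u) (dot-self v))) e)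

dot-negˡ : ∀ {n} (u v : Vec n) → dot (-ᵥ u) v ≡ - dot u v
dot-negˡ u v = trans (Σ-cong (λ i → sym (ℤ.neg-distribˡ-* (u i) (v i)))) (Σ-neg (λ i → u i * v i))

Parametrises : ∀ {m n} → Mat m n → (Vec n → Set) → Set
Parametrises E L =
  (∀ x → L (comb x E)) ×
  (∀ v → L v → ∃ λ x → comb x E ≈ᵥ v) ×
  (∀ x → comb x E ≈ᵥ zeroV → x ≈ᵥ zeroV)

Invertible : ∀ {m} → (Vec m → Vec m) → Set
Invertible φ = (∀ x → ∃ λ c → φ c ≈ᵥ x) × (∀ c → φ c ≈ᵥ zeroV → c ≈ᵥ zeroV)

basis-change : ∀ {m n} {L : Vec n → Set} (E B : Mat m n) (φ : Vec m → Vec m) →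
  (∀ {u v} → u ≈ᵥ v → L u → L v) → Parametrises E L →
  (∀ c → comb c B ≈ᵥ comb (φ c) E) → Invertible φ → IntegralBasis B L
basis-change {m} {L = L} E B φ L-resp (spans , generates , independent) B≈φE (onto , kernel-trivial) =
  rows-in-L , generated , independent-B
  where
  -- the i-th row of B is the combination with the i-th unit vector
  rows-in-L : ∀ i → L (B i)
  rows-in-L i = L-resp (λ j → trans (sym (B≈φE (I m i) j)) (I-·ᵥ (λ l → B l j) i)) (spans (φ (I m i)))

  generated : ∀ v → L v → ∃ λ c → comb c B ≈ᵥ v
  generated v v∈L with generates v v∈L
  ... | x , xE≈v with onto x
  ...   | c , φc≈x = c , λ j → trans (B≈φE c j) (trans (comb-cong E φc≈x j) (xE≈v j))

  independent-B : ∀ c → comb c B ≈ᵥ zeroV → c ≈ᵥ zeroV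
  independent-B c cB≈0 = kernel-trivial c (independent (φ c) (λ j → trans (sym (B≈φE c j)) (cB≈0 j)))

module _ {r k : ℕ} where
  open Blocks r k

  shearᵘ : (Vec k → Vec r) → Vec (r ℕ.+ k) → Vec (r ℕ.+ k)
  shearᵘ f c = (top c +ᵥ f (bot c)) ++ bot c

  shearˡ : (Vec r → Vec k) → Vec (r ℕ.+ k) → Vec (r ℕ.+ k)
  shearˡ g c = top c ++ (bot c +ᵥ g (top c))

  private
    cancel : ∀ a b → (a + - b) + b ≡ a
    cancel = solve-∀

    zero-sum : ∀ {a b} → b ≡ 0ℤ → a + b ≡ 0ℤ → a ≡ 0ℤ
    zero-sum {a} refl a+0≡0 = trans (sym (ℤ.+-identityʳ a)) a+0≡0

  shearᵘ-invertible : (f : Vec k → Vec r) → (∀ {u v} → u ≈ᵥ v → f u ≈ᵥ f v) → f zeroV ≈ᵥ zeroV →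
    Invertible (shearᵘ f)
  shearᵘ-invertible f f-cong f-zero = onto , kernel-trivial
    where
    onto : ∀ x → ∃ λ c → shearᵘ f c ≈ᵥ x
    onto x = c , blocks-ext (shearᵘ f c) x top-eq bot-eq
      where
      c : Vec (r ℕ.+ k)
      c = (top x +ᵥ -ᵥ f (bot x)) ++ bot x
      bot-c : bot c ≈ᵥ bot x
      bot-c = lookup-++ʳ (top x +ᵥ -ᵥ f (bot x)) (bot x)
      top-eq : top (shearᵘ f c) ≈ᵥ top x
      top-eq s = trans (lookup-++ˡ (top c +ᵥ f (bot c)) (bot c) s)
        (trans (cong₂ _+_ (lookup-++ˡ (top x +ᵥ -ᵥ f (bot x)) (bot x) s) (f-cong bot-c s))
               (cancel (top x s) (f (bot x) s)))
      bot-eq : bot (shearᵘ f c) ≈ᵥ bot x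
      bot-eq t = trans (lookup-++ʳ (top c +ᵥ f (bot c)) (bot c) t) (bot-c t)
    kernel-trivial : ∀ c → shearᵘ f c ≈ᵥ zeroV → c ≈ᵥ zeroV
    kernel-trivial c φc≈0 = blocks-ext c zeroV top≡0 bot≡0
      where
      bot≡0 : bot c ≈ᵥ zeroV
      bot≡0 t = trans (sym (lookup-++ʳ (top c +ᵥ f (bot c)) (bot c) t)) (φc≈0 (r ↑ʳ t))
      top≡0 : top c ≈ᵥ zeroV
      top≡0 s = zero-sum (trans (f-cong bot≡0 s) (f-zero s))
        (trans (sym (lookup-++ˡ (top c +ᵥ f (bot c)) (bot c) s)) (φc≈0 (s ↑ˡ k)))

  shearˡ-invertible : (g : Vec r → Vec k) → (∀ {u v} → u ≈ᵥ v → g u ≈ᵥ g v) → g zeroV ≈ᵥ zeroV →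
    Invertible (shearˡ g)
  shearˡ-invertible g g-cong g-zero = onto , kernel-trivial
    where
    onto : ∀ x → ∃ λ c → shearˡ g c ≈ᵥ x
    onto x = c , blocks-ext (shearˡ g c) x top-eq bot-eq
      where
      c : Vec (r ℕ.+ k)
      c = top x ++ (bot x +ᵥ -ᵥ g (top x))
      top-c : top c ≈ᵥ top x
      top-c = lookup-++ˡ (top x) (bot x +ᵥ -ᵥ g (top x))
      top-eq : top (shearˡ g c) ≈ᵥ top x
      top-eq s = trans (lookup-++ˡ (top c) (bot c +ᵥ g (top c)) s) (top-c s)
      bot-eq : bot (shearˡ g c) ≈ᵥ bot x
      bot-eq t = trans (lookup-++ʳ (top c) (bot c +ᵥ g (top c)) t)
        (trans (cong₂ _+_ (lookup-++ʳ (top x) (bot x +ᵥ -ᵥ g (top x)) t) (g-cong top-c t))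
               (cancel (bot x t) (g (top x) t)))
    kernel-trivial : ∀ c → shearˡ g c ≈ᵥ zeroV → c ≈ᵥ zeroV
    kernel-trivial c φc≈0 = blocks-ext c zeroV top≡0 bot≡0
      where
      top≡0 : top c ≈ᵥ zeroV
      top≡0 s = trans (sym (lookup-++ˡ (top c) (bot c +ᵥ g (top c)) s)) (φc≈0 (s ↑ˡ k))
      bot≡0 : bot c ≈ᵥ zeroV
      bot≡0 t = zero-sum (trans (g-cong top≡0 t) (g-zero t))
        (trans (sym (lookup-++ʳ (top c) (bot c +ᵥ g (top c)) t)) (φc≈0 (r ↑ʳ t)))

InImKer-resp : ∀ {m n} (A : Mat m n) {u v : Vec n} → u ≈ᵥ v → InImKer A u → InImKer A v
InImKer-resp A u≈v (x , y , x∈im , y∈ker , u≡x+y) = x , y , x∈im , y∈ker , λ j → trans (sym (u≈v j)) (u≡x+y j)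

module StandardForm {r k : ℕ} (M : Mat r k) where
  open Blocks r k

  D : Mat r (r ℕ.+ k)
  D = Dmat M

  D̂ : Mat k (r ℕ.+ k)
  D̂ = Dhat M

  comb-D : ∀ a → comb a D ≈ᵥ (a ++ comb a M)
  comb-D a j = trans (comb-hcat a (I r) M j) (++-cong _ _ (comb-I a) (λ _ → refl) j)

  comb-D̂ : ∀ b → comb b D̂ ≈ᵥ ((-ᵥ M ·ᵥ b) ++ b)
  comb-D̂ b j = trans (comb-hcat b (negM (transpose M)) (I k) j)
    (++-cong _ _ (λ s → trans (comb-negM b (transpose M) s) (cong -_ (comb-transpose b M s))) (comb-I b) j)

  D-·ᵥ : ∀ u v → D ·ᵥ (u ++ v) ≈ᵥ u +ᵥ M ·ᵥ v
  D-·ᵥ u v i = trans (·ᵥ-hcat (I r) M u v i) (cong (_+ (M ·ᵥ v) i) (I-·ᵥ u i))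

  D̂-in-ker : ∀ b → InKer D (comb b D̂)
  D̂-in-ker b i = begin
    (D ·ᵥ comb b D̂) i           ≡⟨ ·ᵥ-cong D (comb-D̂ b) i ⟩
    (D ·ᵥ ((-ᵥ M ·ᵥ b) ++ b)) i  ≡⟨ D-·ᵥ (-ᵥ M ·ᵥ b) b i ⟩
    - (M ·ᵥ b) i + (M ·ᵥ b) i    ≡⟨ ℤ.+-inverseˡ ((M ·ᵥ b) i) ⟩
    0ℤ                           ∎
    where open ≡-Reasoning

  -- ... and span it: D y = 0 means y₁ = -M y₂, that is y = y₂ D̂.
  ker-D : ∀ y → InKer D y → y ≈ᵥ comb (bot y) D̂
  ker-D y Dy≡0 j = begin
    y j                           ≡⟨ split-++ y j ⟩
    (top y ++ bot y) j            ≡⟨ ++-cong _ _ top-y (λ _ → refl) j ⟩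
    ((-ᵥ M ·ᵥ bot y) ++ bot y) j  ≡⟨ sym (comb-D̂ (bot y) j) ⟩
    comb (bot y) D̂ j             ∎
    where
    open ≡-Reasoning
    top-y : ∀ s → top y s ≡ - (M ·ᵥ bot y) s
    top-y s = inverseˡ-unique (top y s) ((M ·ᵥ bot y) s)
      (trans (sym (D-·ᵥ (top y) (bot y) s)) (trans (sym (·ᵥ-cong D (split-++ y) s)) (Dy≡0 s)))

  E : Mat (r ℕ.+ k) (r ℕ.+ k)
  E = vcat D D̂

  comb-E-rows : ∀ u v → comb (u ++ v) E ≈ᵥ comb u D +ᵥ comb v D̂
  comb-E-rows u v j = trans (comb-vcat (u ++ v) D D̂ j)
    (cong₂ _+_ (comb-cong D (lookup-++ˡ u v) j) (comb-cong D̂ (lookup-++ʳ u v) j))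

  comb-E : ∀ u v → comb (u ++ v) E ≈ᵥ ((u +ᵥ -ᵥ M ·ᵥ v) ++ (comb u M +ᵥ v))
  comb-E u v j = begin
    comb (u ++ v) E j                         ≡⟨ comb-E-rows u v j ⟩
    comb u D j + comb v D̂ j                  ≡⟨ cong₂ _+_ (comb-D u j) (comb-D̂ v j) ⟩
    (u ++ comb u M) j + ((-ᵥ M ·ᵥ v) ++ v) j  ≡⟨ +ᵥ-++ u (-ᵥ M ·ᵥ v) (comb u M) v j ⟩
    ((u +ᵥ -ᵥ M ·ᵥ v) ++ (comb u M +ᵥ v)) j   ∎
    where open ≡-Reasoning

  -- Independence of the rows of E: (a , b) E = 0 gives a = M b and a M = -b,
  -- so ⟨a , a⟩ = ⟨a , M b⟩ = ⟨a M , b⟩ = -⟨b , b⟩.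
  E-independent : ∀ x → comb x E ≈ᵥ zeroV → x ≈ᵥ zeroV
  E-independent x xE≡0 = blocks-ext x zeroV (proj₁ a,b≡0) (proj₂ a,b≡0)
    where
    open ≡-Reasoning
    a : Vec r
    a = top x
    b : Vec k
    b = bot x
    xE-blocks : comb x E ≈ᵥ ((a +ᵥ -ᵥ M ·ᵥ b) ++ (comb a M +ᵥ b))
    xE-blocks j = trans (comb-cong E (split-++ x) j) (comb-E a b j)
    a≡Mb : ∀ s → a s ≡ (M ·ᵥ b) s
    a≡Mb s = x∙y⁻¹≈ε⇒x≈y (a s) ((M ·ᵥ b) s)
      (trans (sym (lookup-++ˡ (a +ᵥ -ᵥ M ·ᵥ b) (comb a M +ᵥ b) s)) (trans (sym (xE-blocks (s ↑ˡ k))) (xE≡0 _)))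
    aM≡-b : ∀ t → comb a M t ≡ - b t
    aM≡-b t = inverseˡ-unique (comb a M t) (b t)
      (trans (sym (lookup-++ʳ (a +ᵥ -ᵥ M ·ᵥ b) (comb a M +ᵥ b) t)) (trans (sym (xE-blocks (r ↑ʳ t))) (xE≡0 _)))
    ⟨a,a⟩≡-⟨b,b⟩ : dot a a ≡ - dot b b
    ⟨a,a⟩≡-⟨b,b⟩ = begin
      dot a a           ≡⟨ Σ-cong (λ s → cong (a s *_) (a≡Mb s)) ⟩
      dot a (M ·ᵥ b)    ≡⟨ dot-adjoint a M b ⟩
      dot (comb a M) b  ≡⟨ Σ-cong (λ t → cong (_* b t) (aM≡-b t)) ⟩
      dot (-ᵥ b) b      ≡⟨ dot-negˡ b b ⟩
      - dot b b         ∎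
    a,b≡0 : a ≈ᵥ zeroV × b ≈ᵥ zeroV
    a,b≡0 = squares-vanish a b (trans (cong (_+ dot b b) ⟨a,a⟩≡-⟨b,b⟩) (ℤ.+-inverseˡ (dot b b)))

  -- E parametrises L: its row combinations x E = x₁ D + x₂ D̂ lie in L,
  -- and an element x + y of L is (x-coefficients , y₂) E.
  E-parametrises : Parametrises E (InImKer D)
  E-parametrises = spans , generates , E-independent
    where
    spans : ∀ x → InImKer D (comb x E)
    spans x = comb (top x) D , comb (bot x) D̂ , (top x , λ _ → refl) , D̂-in-ker (bot x) , comb-vcat x D D̂
    generates : ∀ v → InImKer D v → ∃ λ x → comb x E ≈ᵥ v
    generates v (x , y , (c , cD≡x) , y∈ker , v≡x+y) = c ++ bot y , λ j → begin
      comb (c ++ bot y) E j           ≡⟨ comb-E-rows c (bot y) j ⟩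
      comb c D j + comb (bot y) D̂ j  ≡⟨ cong₂ _+_ (cD≡x j) (sym (ker-D y y∈ker j)) ⟩
      x j + y j                       ≡⟨ sym (v≡x+y j) ⟩
      v j                             ∎
      where open ≡-Reasoning

  -- D′ = ( D ; 0  D̂ D̂ᵀ ) has c D′ = (c₁ + M c₂ , c₂) E, because
  -- D̂ D̂ᵀ = I + Mᵀ M, i.e. b (D̂ D̂ᵀ) = (M b) M + b.
  comb-D̂D̂ᵀ : ∀ b → comb b (D̂ · transpose D̂) ≈ᵥ comb (M ·ᵥ b) M +ᵥ b
  comb-D̂D̂ᵀ b t = begin
    comb b (D̂ · transpose D̂) t                          ≡⟨ comb-· b D̂ (transpose D̂) t ⟩
    comb (comb b D̂) (transpose D̂) t                     ≡⟨ comb-transpose (comb b D̂) D̂ t ⟩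
    (D̂ ·ᵥ comb b D̂) t                                   ≡⟨ ·ᵥ-cong D̂ (comb-D̂ b) t ⟩
    (D̂ ·ᵥ ((-ᵥ M ·ᵥ b) ++ b)) t                          ≡⟨ ·ᵥ-hcat (negM (transpose M)) (I k) (-ᵥ M ·ᵥ b) b t ⟩
    (negM (transpose M) ·ᵥ (-ᵥ M ·ᵥ b)) t + (I k ·ᵥ b) t  ≡⟨ cong₂ _+_ MᵀM (I-·ᵥ b t) ⟩
    comb (M ·ᵥ b) M t + b t                               ∎
    where
    open ≡-Reasoning
    MᵀM : (negM (transpose M) ·ᵥ (-ᵥ M ·ᵥ b)) t ≡ comb (M ·ᵥ b) M t
    MᵀM = begin
      (negM (transpose M) ·ᵥ (-ᵥ M ·ᵥ b)) t  ≡⟨ negM-·ᵥ (transpose M) (-ᵥ M ·ᵥ b) t ⟩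
      - (transpose M ·ᵥ (-ᵥ M ·ᵥ b)) t       ≡⟨ cong -_ (·ᵥ-neg (transpose M) (M ·ᵥ b) t) ⟩
      - - (transpose M ·ᵥ M ·ᵥ b) t          ≡⟨ ℤ.neg-involutive _ ⟩
      (transpose M ·ᵥ M ·ᵥ b) t              ≡⟨ sym (comb-transpose (M ·ᵥ b) (transpose M) t) ⟩
      comb (M ·ᵥ b) M t                      ∎

  φ′ : Vec (r ℕ.+ k) → Vec (r ℕ.+ k)
  φ′ = shearᵘ (M ·ᵥ_)

  comb-D′ : ∀ c → comb c (D′ M) ≈ᵥ comb (φ′ c) E
  comb-D′ c j = begin
    comb c (D′ M) j                                    ≡⟨ comb-vcat c D (hcat zeroM G) j ⟩
    comb a D j + comb b (hcat zeroM G) j               ≡⟨ cong₂ _+_ (comb-D a j) (comb-hcat b zeroM G j) ⟩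
    (a ++ comb a M) j + (comb b zeroM ++ comb b G) j   ≡⟨ +ᵥ-++ a (comb b zeroM) (comb a M) (comb b G) j ⟩
    ((a +ᵥ comb b zeroM) ++ (comb a M +ᵥ comb b G)) j  ≡⟨ ++-cong _ _ top-eq bot-eq j ⟩
    ((a′ +ᵥ -ᵥ M ·ᵥ b) ++ (comb a′ M +ᵥ b)) j          ≡⟨ sym (comb-E a′ b j) ⟩
    comb (φ′ c) E j                                    ∎
    where
    open ≡-Reasoning
    G : Mat k k
    G = D̂ · transpose D̂
    a : Vec r
    a = top c
    b : Vec k
    b = bot c
    a′ : Vec r
    a′ = a +ᵥ M ·ᵥ b
    cancel : ∀ x y → x + 0ℤ ≡ (x + y) + - y
    cancel = solve-∀
    top-eq : ∀ s → a s + comb b zeroM s ≡ a′ s + - (M ·ᵥ b) s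
    top-eq s = trans (cong (a s +_) (comb-zeroM b s)) (cancel (a s) ((M ·ᵥ b) s))
    bot-eq : ∀ t → comb a M t + comb b G t ≡ comb a′ M t + b t
    bot-eq t = begin
      comb a M t + comb b G t                 ≡⟨ cong (comb a M t +_) (comb-D̂D̂ᵀ b t) ⟩
      comb a M t + (comb (M ·ᵥ b) M t + b t)  ≡⟨ sym (ℤ.+-assoc (comb a M t) _ _) ⟩
      (comb a M t + comb (M ·ᵥ b) M t) + b t  ≡⟨ cong (_+ b t) (sym (comb-+ a (M ·ᵥ b) M t)) ⟩
      comb a′ M t + b t                       ∎

  φ′-invertible : Invertible φ′
  φ′-invertible = shearᵘ-invertible (M ·ᵥ_) (·ᵥ-cong M) (·ᵥ-zero M)

  -- D″ = ( D Dᵀ  0 ; D̂ ) has c D″ = (c₁ , c₂ - c₁ M) E, because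
  -- D Dᵀ = I + M Mᵀ, i.e. a (D Dᵀ) = a + M (a M).
  comb-DDᵀ : ∀ a → comb a (D · transpose D) ≈ᵥ a +ᵥ M ·ᵥ comb a M
  comb-DDᵀ a s = begin
    comb a (D · transpose D) s       ≡⟨ comb-· a D (transpose D) s ⟩
    comb (comb a D) (transpose D) s  ≡⟨ comb-transpose (comb a D) D s ⟩
    (D ·ᵥ comb a D) s                ≡⟨ ·ᵥ-cong D (comb-D a) s ⟩
    (D ·ᵥ (a ++ comb a M)) s         ≡⟨ D-·ᵥ a (comb a M) s ⟩
    a s + (M ·ᵥ comb a M) s          ∎
    where open ≡-Reasoning

  φ″ : Vec (r ℕ.+ k) → Vec (r ℕ.+ k)
  φ″ = shearˡ (λ a → -ᵥ comb a M)

  comb-D″ : ∀ c → comb c (D″ M) ≈ᵥ comb (φ″ c) E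
  comb-D″ c j = begin
    comb c (D″ M) j                                      ≡⟨ comb-vcat c (hcat H zeroM) D̂ j ⟩
    comb a (hcat H zeroM) j + comb b D̂ j                ≡⟨ cong₂ _+_ (comb-hcat a H zeroM j) (comb-D̂ b j) ⟩
    (comb a H ++ comb a zeroM) j + ((-ᵥ M ·ᵥ b) ++ b) j  ≡⟨ +ᵥ-++ (comb a H) (-ᵥ M ·ᵥ b) (comb a zeroM) b j ⟩
    ((comb a H +ᵥ -ᵥ M ·ᵥ b) ++ (comb a zeroM +ᵥ b)) j   ≡⟨ ++-cong _ _ top-eq bot-eq j ⟩
    ((a +ᵥ -ᵥ M ·ᵥ b′) ++ (comb a M +ᵥ b′)) j            ≡⟨ sym (comb-E a b′ j) ⟩
    comb (φ″ c) E j                                      ∎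
    where
    open ≡-Reasoning
    H : Mat r r
    H = D · transpose D
    a : Vec r
    a = top c
    b : Vec k
    b = bot c
    b′ : Vec k
    b′ = b +ᵥ -ᵥ comb a M
    regroup : ∀ x y z → (x + z) + - y ≡ x + - (y + - z)
    regroup = solve-∀
    cancel : ∀ x y → 0ℤ + y ≡ x + (y + - x)
    cancel = solve-∀
    top-eq : ∀ s → comb a H s + - (M ·ᵥ b) s ≡ a s + - (M ·ᵥ b′) s
    top-eq s = begin
      comb a H s + - (M ·ᵥ b) s                      ≡⟨ cong (_+ - (M ·ᵥ b) s) (comb-DDᵀ a s) ⟩
      (a s + (M ·ᵥ comb a M) s) + - (M ·ᵥ b) s       ≡⟨ regroup (a s) ((M ·ᵥ b) s) ((M ·ᵥ comb a M) s) ⟩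
      a s + - ((M ·ᵥ b) s + - (M ·ᵥ comb a M) s)     ≡⟨ cong (λ w → a s + - ((M ·ᵥ b) s + w)) (sym (·ᵥ-neg M (comb a M) s)) ⟩
      a s + - ((M ·ᵥ b) s + (M ·ᵥ (-ᵥ comb a M)) s)  ≡⟨ cong (λ w → a s + - w) (sym (·ᵥ-+ M b (-ᵥ comb a M) s)) ⟩
      a s + - (M ·ᵥ b′) s                            ∎
    bot-eq : ∀ t → comb a zeroM t + b t ≡ comb a M t + b′ t
    bot-eq t = trans (cong (_+ b t) (comb-zeroM a t)) (cancel (comb a M t) (b t))

  φ″-invertible : Invertible φ″
  φ″-invertible = shearˡ-invertible (λ a → -ᵥ comb a M) (λ e t → cong -_ (comb-cong M e t))
    (λ t → cong -_ (Σ-zero (λ i → 0ℤ * M i t) (λ _ → refl)))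

proposition7p2 : (r k : ℕ) (M : Mat r k) →
    IntegralBasis (D′ M) (InImKer (Dmat M)) × IntegralBasis (D″ M) (InImKer (Dmat M))
proposition7p2 r k M =
  basis-change E (D′ M) φ′ (InImKer-resp D) E-parametrises comb-D′ φ′-invertible ,
  basis-change E (D″ M) φ″ (InImKer-resp D) E-parametrises comb-D″ φ″-invertible
  where open StandardForm M
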